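{- Let $\pi$ be a simple permutation of length $n\ge 4$ avoiding both $2143$ and $4231$. Let $\ell$ be its leftmost point, $r$ its rightmost point, $u$ its highest point (value $n$) and $d$ its lowest point (value $1$). If the four points $\ell,r,u,d$ form the pattern $3412$ (i.e. in left-to-right order they are $\ell,u,d,r$ and their values satisfy $d<r<\ell<u$), then $\pi$ is $42513$ or $35142$.
   Context: A permutation of length $n$ is an arrangement $\pi(1)\cdots\pi(n)$ of $1,\dots,n$, viewed as the set of points $(i,\pi(i))$ in the plane. $\pi$ is contained in $\sigma$ if some subsequence of $\sigma$ is in the same relative order as $\pi$; otherwise $\sigma$ avoids $\pi$. A set of points forms the pattern $\tau$ if, read left to right, their values are in the same relative order as $\tau$. An interval is a set of contiguous entries whose values form a set of consecutive integers; it is trivial if of size $1$ or the whole permutation. A permutation is simple if all its intervals are trivial. -}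

module Defs where

open import Data.Nat using (ℕ; zero; suc; _≤_; _<_)
open import Data.Fin using (Fin; toℕ)
open import Data.List using (List; []; _∷_; length)
open import Data.Product using (Σ; _×_; ∃)
open import Data.Sum using (_⊎_)
open import Data.Empty using (⊥)
open import Function using (_⇔_)
open import Function.Definitions using (Injective)
open import Relation.Binary.PropositionalEquality using (_≡_)

-- A permutation of length n: an injective (hence bijective) map Fin n → Fin n,
-- position i (0-based) ↦ value π i (0-based).  Point i is (i , π i).
IsPermutation : {n : ℕ} → (Fin n → Fin n) → Set
IsPermutation π = Injective _≡_ _≡_ π

nth : List ℕ → ℕ → ℕ
nth []       _       = 0
nth (x ∷ xs) zero    = x
nth (x ∷ xs) (suc i) = nth xs i

Contains : (τ : List ℕ) → {n : ℕ} → (Fin n → Fin n) → Set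
Contains τ {n} π =
  Σ (Fin (length τ) → Fin n) λ f →
    ((i j : Fin (length τ)) → toℕ i < toℕ j → toℕ (f i) < toℕ (f j)) ×
    ((i j : Fin (length τ)) →
       (nth τ (toℕ i) < nth τ (toℕ j)) ⇔ (toℕ (π (f i)) < toℕ (π (f j))))

Avoids : (τ : List ℕ) → {n : ℕ} → (Fin n → Fin n) → Set
Avoids τ π = Contains τ π → ⊥

IsInterval : {n : ℕ} → (Fin n → Fin n) → ℕ → ℕ → Set
IsInterval {n} π a b =
  a ≤ b × b < n ×
  ((i j : Fin n) → a ≤ toℕ i → toℕ i ≤ b → a ≤ toℕ j → toℕ j ≤ b →
    (v : ℕ) → toℕ (π i) ≤ v → v ≤ toℕ (π j) →
    ∃ λ (k : Fin n) → a ≤ toℕ k × toℕ k ≤ b × toℕ (π k) ≡ v)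

IsTrivialInterval : ℕ → ℕ → ℕ → Set
IsTrivialInterval n a b = a ≡ b ⊎ (a ≡ 0 × suc b ≡ n)

IsSimple : {n : ℕ} → (Fin n → Fin n) → Set
IsSimple {n} π = (a b : ℕ) → IsInterval π a b → IsTrivialInterval n a b

-- π equals the permutation with one-line notation ws (values 1-based).
OneLine : {n : ℕ} → (Fin n → Fin n) → List ℕ → Set
OneLine {n} π ws = (length ws ≡ n) × ((i : Fin n) → suc (toℕ (π i)) ≡ nth ws (toℕ i))

-- Let ℓ, u, d, r sit at positions 0 < up < down < m, with L = π ℓ and R = π r, so that
-- 0 = π d < R < L < π u = m. Call A, B, C the points strictly between ℓ and u, u and d,
-- d and r. If a point a of A lies below R, the two patterns force the points before a, the
-- points after a up to u, the points after u below π a, and the points after those, to form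
-- intervals; simplicity shrinks each to a single point, and 42513 is all that is left.
-- If a point of C lies above L, the same holds for the reverse-complement of π, which keeps
-- simplicity, both patterns and the corner configuration, and turns 42513 into 35142.
-- Otherwise B decreases, and if k is the last point of B above R then everything after k
-- lies below everything up to k, so the positions 0..k form a nontrivial interval.

module Submission where

open import Defs
open import Data.Nat using (ℕ; zero; suc; pred; _≤_; _<_; _∸_; z≤n; s≤s; z<s)
open import Data.Nat.Properties
open import Data.Fin using (Fin; toℕ; zero; fromℕ; fromℕ<; punchOut)
open import Data.Fin.Properties
  using (toℕ<n; toℕ-fromℕ; toℕ-fromℕ<; fromℕ<-toℕ; toℕ-injective; any?; pigeonhole; punchOut-injective)
  renaming (_≟_ to _≟ᶠ_)
open import Data.List using (List; []; _∷_; length; map)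
open import Data.List.Properties using (length-map)
open import Data.List.Relation.Unary.Linked using (Linked; [-]; _∷_)
open import Data.Product using (_×_; _,_; ∃)
import Data.Product as Product
open import Data.Sum using (_⊎_; inj₁; inj₂)
import Data.Sum as Sum
open import Data.Empty using (⊥; ⊥-elim)
open import Function using (_∘_; mk⇔)
open import Function.Definitions using (Injective)
open import Relation.Nullary using (¬_; Dec; yes; no; contradiction)
open import Relation.Nullary.Decidable using (_×-dec_; True; toWitness)
open import Relation.Unary using (Decidable)
open import Relation.Binary using (tri<; tri≈; tri>)
open import Relation.Binary.PropositionalEquality

record Crossing (P : ℕ → Set) (s e : ℕ) : Set where
  field
    point       : ℕ
    from≤       : s ≤ point
    <to         : point < e
    holds       : P point
    fails-after : ¬ P (suc point)

crossing : {P : ℕ → Set} → Decidable P → ∀ {s e} → s ≤ e → P s → ¬ P e → Crossing P s e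
crossing P? {e = zero} z≤n Ps ¬Pe = contradiction Ps ¬Pe
crossing P? {s} {suc e} s≤1+e Ps ¬P1+e with m≤n⇒m<n∨m≡n s≤1+e
... | inj₂ refl = contradiction Ps ¬P1+e
... | inj₁ (s≤s s≤e) with P? e
...   | yes Pe  = record { point = e ; from≤ = s≤e ; <to = ≤-refl ; holds = Pe ; fails-after = ¬P1+e }
...   | no ¬Pe  = record
        { point = point ; from≤ = from≤ ; <to = m<n⇒m<1+n <to ; holds = holds ; fails-after = fails-after }
  where open Crossing (crossing P? s≤e Ps ¬Pe)

nth-increasing : ∀ {xs} → Linked _<_ xs → ∀ {x y} → x < y → y < length xs → nth xs x < nth xs y
nth-increasing (r ∷ _)  {zero}  {suc zero}    _         _           = r
nth-increasing (r ∷ rs) {zero}  {suc (suc y)} _         (s≤s y<len) = <-trans r (nth-increasing rs z<s y<len)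
nth-increasing (_ ∷ rs) {suc x} {suc y}       (s≤s x<y) (s≤s y<len) = nth-increasing rs x<y y<len
nth-increasing [-]      {_}     {suc _}       _         (s≤s ())

nth-map : ∀ (f : ℕ → ℕ) xs {k} → k < length xs → nth (map f xs) k ≡ f (nth xs k)
nth-map f (_ ∷ _)  {zero}  _         = refl
nth-map f (_ ∷ xs) {suc k} (s≤s k<n) = nth-map f xs k<n

-- σ lists the (0-based) positions of τ in increasing order of value.
IsInverse : List ℕ → List ℕ → Set
IsInverse τ σ =
  ∀ {x} → x < length τ → 1 ≤ nth τ x × nth τ x ∸ 1 < length σ × nth σ (nth τ x ∸ 1) ≡ x

inverse? : ∀ τ σ → Dec (IsInverse τ σ)
inverse? τ σ = allUpTo?
  (λ x → 1 ≤? nth τ x ×-dec (nth τ x ∸ 1 <? length σ ×-dec nth σ (nth τ x ∸ 1) ≟ x)) (length τ)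

three-between-0-and-4 : ∀ {x y z} → 0 < x → x < y → y < z → z < 4 → x ≡ 1 × y ≡ 2 × z ≡ 3
three-between-0-and-4 (s≤s z≤n) (s≤s (s≤s z≤n)) (s≤s (s≤s (s≤s z≤n))) (s≤s (s≤s (s≤s (s≤s z≤n)))) =
  refl , refl , refl

∸-reflect-< : ∀ {m x y} → m ∸ x < m ∸ y → y < x
∸-reflect-< {m} h = ≰⇒> λ x≤y → <⇒≱ h (∸-monoʳ-≤ m x≤y)

m∸n≤o⇒m∸o≤n : ∀ {m n o} → n ≤ m → m ∸ n ≤ o → m ∸ o ≤ n
m∸n≤o⇒m∸o≤n {m} n≤m h = subst (_ ≤_) (m∸[m∸n]≡n n≤m) (∸-monoʳ-≤ m h)

o≤m∸n⇒n≤m∸o : ∀ {m n o} → n ≤ m → o ≤ m ∸ n → n ≤ m ∸ o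
o≤m∸n⇒n≤m∸o {m} n≤m h = subst (_≤ _) (m∸[m∸n]≡n n≤m) (∸-monoʳ-≤ m h)

o<m∸n⇒n<m∸o : ∀ {m n o} → n ≤ m → o < m ∸ n → n < m ∸ o
o<m∸n⇒n<m∸o {m} {n} n≤m h = subst (_< _) (m∸[m∸n]≡n n≤m) (∸-monoʳ-< h (m∸n≤m m n))

m∸n<o⇒m∸o<n : ∀ {m n o} → n ≤ m → o ≤ m → m ∸ n < o → m ∸ o < n
m∸n<o⇒m∸o<n n≤m o≤m h = subst (_ <_) (m∸[m∸n]≡n n≤m) (∸-monoʳ-< h o≤m)

HasOneLine : ℕ → (ℕ → ℕ) → List ℕ → Set
HasOneLine m p ws = length ws ≡ suc m × (∀ {k} → k ≤ m → suc (p k) ≡ nth ws k)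

five-values : ∀ {p : ℕ → ℕ} {v₀ v₁ v₂ v₃ v₄} →
  p 0 ≡ v₀ → p 1 ≡ v₁ → p 2 ≡ v₂ → p 3 ≡ v₃ → p 4 ≡ v₄ →
  HasOneLine 4 p (suc v₀ ∷ suc v₁ ∷ suc v₂ ∷ suc v₃ ∷ suc v₄ ∷ [])
five-values {p} {v₀} {v₁} {v₂} {v₃} {v₄} e₀ e₁ e₂ e₃ e₄ = refl , values
  where
  values : ∀ {k} → k ≤ 4 → suc (p k) ≡ nth (suc v₀ ∷ suc v₁ ∷ suc v₂ ∷ suc v₃ ∷ suc v₄ ∷ []) k
  values {0} _ = cong suc e₀
  values {1} _ = cong suc e₁
  values {2} _ = cong suc e₂
  values {3} _ = cong suc e₃
  values {4} _ = cong suc e₄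
  values {suc (suc (suc (suc (suc _))))} (s≤s (s≤s (s≤s (s≤s ()))))

IsBlock : ℕ → (ℕ → ℕ) → ℕ → ℕ → Set
IsBlock m p a b = ∀ k → k ≤ m → k < a ⊎ b < k →
  (∀ i → a ≤ i → i ≤ b → p k < p i) ⊎ (∀ i → a ≤ i → i ≤ b → p i < p k)

record SimpleAvoider (m : ℕ) (p : ℕ → ℕ) : Set where
  field
    bounded     : ∀ {k} → k ≤ m → p k ≤ m
    injective   : ∀ {i j} → i ≤ m → j ≤ m → p i ≡ p j → i ≡ j
    avoids-2143 : ∀ {a b c d} → a < b → b < c → c < d → d ≤ m →
                  p b < p a → p a < p d → p d < p c → ⊥
    avoids-4231 : ∀ {a b c d} → a < b → b < c → c < d → d ≤ m →
                  p d < p b → p b < p c → p c < p a → ⊥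
    simple      : ∀ {a b} → a ≤ b → b ≤ m → IsBlock m p a b → a ≡ b ⊎ (a ≡ 0 × b ≡ m)

  compare : ∀ {i j} → i ≤ m → j ≤ m → i ≢ j → p i < p j ⊎ p j < p i
  compare i≤m j≤m i≢j with <-cmp (p _) (p _)
  ... | tri< lt _ _ = inj₁ lt
  ... | tri≈ _ eq _ = contradiction (injective i≤m j≤m eq) i≢j
  ... | tri> _ _ gt = inj₂ gt

  p≯⇒p< : ∀ {i j} → i ≤ m → j ≤ m → i ≢ j → ¬ p j < p i → p i < p j
  p≯⇒p< i≤m j≤m i≢j ¬gt = Sum.[ (λ lt → lt) , (λ gt → contradiction gt ¬gt) ]′ (compare i≤m j≤m i≢j)

record Corners (m : ℕ) (p : ℕ → ℕ) : Set where
  field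
    up down    : ℕ
    p-up       : p up ≡ m
    p-down     : p down ≡ 0
    0<up       : 0 < up
    up<down    : up < down
    down<m     : down < m
    last<first : p m < p 0

reverse-complement : ℕ → (ℕ → ℕ) → ℕ → ℕ
reverse-complement m p k = m ∸ p (m ∸ k)

module ReverseComplement {m : ℕ} {p : ℕ → ℕ} (S : SimpleAvoider m p) where
  open SimpleAvoider S

  p̃ : ℕ → ℕ
  p̃ = reverse-complement m p

  p̃-reflect : ∀ {x} → x ≤ m → p̃ (m ∸ x) ≡ m ∸ p x
  p̃-reflect x≤m = cong (λ y → m ∸ p y) (m∸[m∸n]≡n x≤m)

  reflect-< : ∀ {k i} → k ≤ m → i ≤ m → p̃ (m ∸ k) < p̃ (m ∸ i) → p i < p k
  reflect-< k≤m i≤m h = ∸-reflect-< (subst₂ _<_ (p̃-reflect k≤m) (p̃-reflect i≤m) h)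

  block-reflect : ∀ {a b} → a ≤ m → b ≤ m → IsBlock m p̃ a b → IsBlock m p (m ∸ b) (m ∸ a)
  block-reflect {a} {b} a≤m b≤m block k k≤m outside
    with block (m ∸ k) (m∸n≤m m k)
           (Sum.swap (Sum.map (o<m∸n⇒n<m∸o b≤m) (m∸n<o⇒m∸o<n a≤m k≤m) outside))
  ... | inj₁ below = inj₂ λ i mb≤i i≤ma →
          reflect-< k≤m (≤-trans i≤ma (m∸n≤m m a))
            (below (m ∸ i) (o≤m∸n⇒n≤m∸o a≤m i≤ma) (m∸n≤o⇒m∸o≤n b≤m mb≤i))
  ... | inj₂ above = inj₁ λ i mb≤i i≤ma →
          reflect-< (≤-trans i≤ma (m∸n≤m m a)) k≤m
            (above (m ∸ i) (o≤m∸n⇒n≤m∸o a≤m i≤ma) (m∸n≤o⇒m∸o≤n b≤m mb≤i))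

  reflect-value : ∀ x y → p̃ x < p̃ y → p (m ∸ y) < p (m ∸ x)
  reflect-value x y = ∸-reflect-< {m} {p (m ∸ x)} {p (m ∸ y)}

  reflected : SimpleAvoider m p̃
  reflected = record
    { bounded     = λ {k} _ → m∸n≤m m (p (m ∸ k))
    ; injective   = λ {i} {j} i≤m j≤m eq →
        ∸-cancelˡ-≡ i≤m j≤m (injective (m∸n≤m m i) (m∸n≤m m j)
          (∸-cancelˡ-≡ (bounded (m∸n≤m m i)) (bounded (m∸n≤m m j)) eq))
    ; avoids-2143 = λ {a} {b} {c} {d} a<b b<c c<d d≤m pb<pa pa<pd pd<pc →
        avoids-2143 (∸-monoʳ-< c<d d≤m) (∸-monoʳ-< b<c (<⇒≤ (<-≤-trans c<d d≤m)))
          (∸-monoʳ-< a<b (<⇒≤ (<-trans b<c (<-≤-trans c<d d≤m)))) (m∸n≤m m a)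
          (reflect-value d c pd<pc) (reflect-value a d pa<pd) (reflect-value b a pb<pa)
    ; avoids-4231 = λ {a} {b} {c} {d} a<b b<c c<d d≤m pd<pb pb<pc pc<pa →
        avoids-4231 (∸-monoʳ-< c<d d≤m) (∸-monoʳ-< b<c (<⇒≤ (<-≤-trans c<d d≤m)))
          (∸-monoʳ-< a<b (<⇒≤ (<-trans b<c (<-≤-trans c<d d≤m)))) (m∸n≤m m a)
          (reflect-value c a pc<pa) (reflect-value b c pb<pc) (reflect-value d b pd<pb)
    ; simple      = λ {a} {b} a≤b b≤m block →
        trivial-reflect (≤-trans a≤b b≤m) b≤m
          (simple (∸-monoʳ-≤ m a≤b) (m∸n≤m m a) (block-reflect (≤-trans a≤b b≤m) b≤m block))
    }
    where
    trivial-reflect : ∀ {a b} → a ≤ m → b ≤ m → m ∸ b ≡ m ∸ a ⊎ (m ∸ b ≡ 0 × m ∸ a ≡ m) →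
                      a ≡ b ⊎ (a ≡ 0 × b ≡ m)
    trivial-reflect a≤m b≤m (inj₁ eq) = inj₁ (sym (∸-cancelˡ-≡ b≤m a≤m eq))
    trivial-reflect {a} a≤m b≤m (inj₂ (mb≡0 , ma≡m)) =
      inj₂ (trans (sym (m∸[m∸n]≡n a≤m)) (trans (cong (m ∸_) ma≡m) (n∸n≡0 m))
           , ≤-antisym b≤m (m∸n≡0⇒m≤n mb≡0))

  reflected-corners : Corners m p → Corners m p̃
  reflected-corners C = record
    { up         = m ∸ down
    ; down       = m ∸ up
    ; p-up       = trans (p̃-reflect (<⇒≤ down<m)) (cong (m ∸_) p-down)
    ; p-down     = trans (p̃-reflect up≤m) (trans (cong (m ∸_) p-up) (n∸n≡0 m))
    ; 0<up       = m<n⇒0<n∸m down<m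
    ; up<down    = ∸-monoʳ-< up<down (<⇒≤ down<m)
    ; down<m     = ∸-monoʳ-< 0<up up≤m
    ; last<first = subst (λ x → m ∸ p x < m ∸ p m) (sym (n∸n≡0 m))
                     (∸-monoʳ-< last<first (bounded z≤n))
    }
    where
    open Corners C
    up≤m : up ≤ m
    up≤m = <⇒≤ (<-trans up<down down<m)

  reflected-low-point : ∀ {q} → q ≤ m → p 0 < p q → p̃ (m ∸ q) < p̃ m
  reflected-low-point q≤m L<pq =
    subst₂ _<_ (sym (p̃-reflect q≤m)) (sym (p̃-reflect z≤n)) (∸-monoʳ-< L<pq (bounded q≤m))

unreverse-42513 : ∀ {m p} → (∀ {k} → k ≤ m → p k ≤ m) →
  HasOneLine m (reverse-complement m p) (4 ∷ 2 ∷ 5 ∷ 1 ∷ 3 ∷ []) → HasOneLine m p (3 ∷ 5 ∷ 1 ∷ 4 ∷ 2 ∷ [])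
unreverse-42513 {p = p} bounded (refl , values) = five-values (value 0) (value 1) (value 2) (value 3) (value 4)
  where
  value : ∀ k → p (4 ∸ (4 ∸ k)) ≡ 4 ∸ pred (nth (4 ∷ 2 ∷ 5 ∷ 1 ∷ 3 ∷ []) (4 ∸ k))
  value k = trans (sym (m∸[m∸n]≡n (bounded (m∸n≤m 4 (4 ∸ k)))))
                  (cong (λ x → 4 ∸ pred x) (values (m∸n≤m 4 k)))

module Configuration {m : ℕ} {p : ℕ → ℕ} (S : SimpleAvoider m p) (C : Corners m p) where
  open SimpleAvoider S
  open Corners C

  L R : ℕ
  L = p 0
  R = p m

  up<m : up < m
  up<m = <-trans up<down down<m

  up≤m : up ≤ m
  up≤m = <⇒≤ up<m

  down≤m : down ≤ m
  down≤m = <⇒≤ down<m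

  below-up : ∀ {k} → k ≤ m → k ≢ up → p k < p up
  below-up k≤m k≢up =
    ≤∧≢⇒< (subst (p _ ≤_) (sym p-up) (bounded k≤m)) (λ eq → k≢up (injective k≤m up≤m eq))

  above-down : ∀ {k} → k ≤ m → k ≢ down → p down < p k
  above-down k≤m k≢down =
    subst (_< p _) (sym p-down) (n≢0⇒n>0 λ eq → k≢down (injective k≤m down≤m (trans eq (sym p-down))))

  pdown<R : p down < R
  pdown<R = above-down ≤-refl (>⇒≢ down<m)

  R<pup : R < p up
  R<pup = below-up ≤-refl (>⇒≢ up<m)

  L<pup : L < p up
  L<pup = below-up z≤n (<⇒≢ 0<up)

  -- a = suc a′, so that the points before a occupy the positions 0..a′
  module LowPointInA (a′ : ℕ) (a<up : suc a′ < up) (pa<R : p (suc a′) < R) where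
    a : ℕ
    a = suc a′

    a<down : a < down
    a<down = <-trans a<up up<down

    a≤m : a ≤ m
    a≤m = <⇒≤ (<-trans a<down down<m)

    pa<L : p a < L
    pa<L = <-trans pa<R last<first

    pdown<pa : p down < p a
    pdown<pa = above-down a≤m (<⇒≢ a<down)

    B-below-a : ∀ {q} → up < q → q < down → p q < p a
    B-below-a {q} up<q q<down = p≯⇒p< q≤m a≤m (>⇒≢ a<q) refute
      where
      a<q = <-trans a<up up<q
      q≤m = <⇒≤ (<-trans q<down down<m)
      refute : ¬ p a < p q
      refute pa<pq with compare q≤m z≤n (>⇒≢ (<-trans 0<up up<q))
      ... | inj₁ pq<L = avoids-4231 z<s a<q q<down down≤m pdown<pa pa<pq pq<L
      ... | inj₂ L<pq = avoids-2143 z<s a<up up<q q≤m pa<L L<pq (below-up q≤m (>⇒≢ up<q))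

    C-below-R : ∀ {q} → down < q → q < m → p q < R
    C-below-R down<q q<m = p≯⇒p< (<⇒≤ q<m) ≤-refl (<⇒≢ q<m) λ R<pq →
      avoids-2143 a<down down<q q<m ≤-refl pdown<pa pa<R R<pq

    after-up-≤R : ∀ {q} → up < q → q ≤ m → p q ≤ R
    after-up-≤R {q} up<q q≤m with <-cmp q down
    ... | tri< q<down _ _ = <⇒≤ (<-trans (B-below-a up<q q<down) pa<R)
    ... | tri≈ _ refl _   = <⇒≤ pdown<R
    ... | tri> _ _ down<q with m≤n⇒m<n∨m≡n q≤m
    ...   | inj₁ q<m  = <⇒≤ (C-below-R down<q q<m)
    ...   | inj₂ refl = ≤-refl

    A-above-R : ∀ {i} → 0 < i → i < up → i ≢ a → R < p i
    A-above-R {i} 0<i i<up i≢a = p≯⇒p< ≤-refl i≤m (>⇒≢ i<m) refute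
      where
      i<m = <-trans i<up up<m
      i≤m = <⇒≤ i<m
      refute : ¬ p i < R
      refute pi<R with <-cmp i a | compare i≤m a≤m i≢a
      ... | tri< i<a _ _ | inj₁ pi<pa = avoids-4231 0<i i<a a<down down≤m
                                           (above-down i≤m (<⇒≢ (<-trans i<up up<down))) pi<pa pa<L
      ... | tri< i<a _ _ | inj₂ pa<pi = avoids-2143 i<a a<up up<m ≤-refl pa<pi pi<R R<pup
      ... | tri> _ _ a<i | inj₁ pi<pa = avoids-2143 a<i i<up up<m ≤-refl pi<pa pa<R R<pup
      ... | tri> _ _ a<i | inj₂ pa<pi = avoids-4231 z<s a<i (<-trans i<up up<down) down≤m
                                           pdown<pa pa<pi (<-trans pi<R last<first)
      ... | tri≈ _ i≡a _ | _ = i≢a i≡a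

    after-a-above-L : ∀ {k} → a < k → k < up → L < p k
    after-a-above-L {k} a<k k<up = p≯⇒p< z≤n k≤m (<⇒≢ (<-trans z<s a<k)) λ pk<L →
      avoids-4231 z<s a<k (<-trans k<up up<down) down≤m pdown<pa
        (<-trans pa<R (A-above-R (<-trans z<s a<k) k<up (>⇒≢ a<k))) pk<L
      where k≤m = <⇒≤ (<-trans k<up up<m)

    before-a-below-after-a : ∀ {j k} → j < a → a < k → k < up → p j < p k
    before-a-below-after-a {zero}  _   a<k k<up = after-a-above-L a<k k<up
    before-a-below-after-a {suc j} j<a a<k k<up = p≯⇒p< j≤m k≤m (<⇒≢ (<-trans j<a a<k)) λ pk<pj →
      avoids-4231 j<a a<k (<-trans k<up up<down) down≤m pdown<pa
        (<-trans pa<L (after-a-above-L a<k k<up)) pk<pj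
      where
      j≤m = <⇒≤ (<-trans j<a (<-trans a<up up<m))
      k≤m = <⇒≤ (<-trans k<up up<m)

    before-a-above-R : ∀ {i} → i < a → R < p i
    before-a-above-R {zero}  _   = last<first
    before-a-above-R {suc i} i<a = A-above-R z<s (<-trans i<a a<up) (<⇒≢ i<a)

    before-up-above-R : ∀ {k} → k ≤ up → k ≢ a → R < p k
    before-up-above-R {k} k≤up k≢a with <-cmp k a
    ... | tri< k<a _ _ = before-a-above-R k<a
    ... | tri≈ _ k≡a _ = contradiction k≡a k≢a
    ... | tri> _ _ a<k with m≤n⇒m<n∨m≡n k≤up
    ...   | inj₁ k<up = <-trans last<first (after-a-above-L a<k k<up)
    ...   | inj₂ refl = R<pup

    prefix-block : IsBlock m p 0 a′
    prefix-block k k≤m (inj₁ ())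
    prefix-block k k≤m (inj₂ a′<k) with m≤n⇒m<n∨m≡n a′<k
    ... | inj₂ refl = inj₁ λ i _ i≤a′ → <-trans pa<R (before-a-above-R (s≤s i≤a′))
    ... | inj₁ a<k with <-cmp k up
    ...   | tri< k<up _ _ = inj₂ λ i _ i≤a′ → before-a-below-after-a (s≤s i≤a′) a<k k<up
    ...   | tri≈ _ refl _ = inj₂ λ i _ i≤a′ →
              below-up (≤-trans (n≤1+n i) (≤-trans (s≤s i≤a′) a≤m)) (<⇒≢ (<-trans (s≤s i≤a′) a<up))
    ...   | tri> _ _ up<k = inj₁ λ i _ i≤a′ → ≤-<-trans (after-up-≤R up<k k≤m) (before-a-above-R (s≤s i≤a′))

    a′≡0 : a′ ≡ 0
    a′≡0 with simple z≤n (≤-trans (n≤1+n a′) a≤m) prefix-block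
    ... | inj₁ 0≡a′       = sym 0≡a′
    ... | inj₂ (_ , a′≡m) = contradiction a′≡m (<⇒≢ (<-≤-trans (n<1+n a′) a≤m))

    after-a-to-up-above-L : ∀ {i} → a < i → i ≤ up → L < p i
    after-a-to-up-above-L a<i i≤up with m≤n⇒m<n∨m≡n i≤up
    ... | inj₁ i<up = after-a-above-L a<i i<up
    ... | inj₂ refl = L<pup

    rise-block : IsBlock m p (suc a) up
    rise-block k k≤m (inj₁ k<1+a) = inj₁ λ i a<i i≤up → below-rise (≤-pred k<1+a) a<i i≤up
      where
      below-rise : ∀ {i} → k ≤ a → a < i → i ≤ up → p k < p i
      below-rise k≤a a<i i≤up with m≤n⇒m<n∨m≡n k≤a | m≤n⇒m<n∨m≡n i≤up
      ... | inj₂ refl | _         = <-trans pa<L (after-a-to-up-above-L a<i i≤up)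
      ... | inj₁ k<a  | inj₁ i<up = before-a-below-after-a k<a a<i i<up
      ... | inj₁ k<a  | inj₂ refl = below-up k≤m (<⇒≢ (<-trans k<a a<up))
    rise-block k k≤m (inj₂ up<k) = inj₁ λ i a<i i≤up →
      ≤-<-trans (after-up-≤R up<k k≤m) (<-trans last<first (after-a-to-up-above-L a<i i≤up))

    up≡2+a′ : suc a ≡ up
    up≡2+a′ with simple a<up up≤m rise-block
    ... | inj₁ eq     = eq
    ... | inj₂ (() , _)

    stays-above-a : ∀ {q r} → up < q → q < r → r ≤ m → p a < p q → p a < p r
    stays-above-a up<q q<r r≤m pa<pq = p≯⇒p< a≤m r≤m (<⇒≢ (<-trans (<-trans a<up up<q) q<r)) λ pr<pa →
      avoids-4231 z<s (<-trans a<up up<q) q<r r≤m pr<pa pa<pq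
        (≤-<-trans (after-up-≤R up<q (<⇒≤ (<-≤-trans q<r r≤m))) last<first)

    1+up-below-a : p (suc up) < p a
    1+up-below-a with m≤n⇒m<n∨m≡n up<down
    ... | inj₁ 1+up<down = B-below-a ≤-refl 1+up<down
    ... | inj₂ refl      = pdown<pa

    open Crossing (crossing (λ x → p x <? p a) up<m 1+up-below-a (<-asym pa<R))
      renaming (point to j; from≤ to up<j; <to to j<m; holds to pj<pa; fails-after to ¬p1+j<pa)

    up<1+j : up < suc j
    up<1+j = ≤-trans up<j (n≤1+n j)

    pa<p1+j : p a < p (suc j)
    pa<p1+j = p≯⇒p< a≤m j<m (<⇒≢ (<-trans a<up up<1+j)) ¬p1+j<pa

    up-to-j-below-a : ∀ {x} → up < x → x ≤ j → p x < p a
    up-to-j-below-a {x} up<x x≤j = p≯⇒p< x≤m a≤m (>⇒≢ (<-trans a<up up<x)) λ pa<px →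
      <-asym pj<pa (Sum.[ (λ x<j → stays-above-a up<x x<j (<⇒≤ j<m) pa<px) , (λ { refl → pa<px }) ]′
                     (m≤n⇒m<n∨m≡n x≤j))
      where x≤m = ≤-trans x≤j (<⇒≤ j<m)

    after-j-above-a : ∀ {k} → j < k → k ≤ m → p a < p k
    after-j-above-a j<k k≤m with m≤n⇒m<n∨m≡n j<k
    ... | inj₂ refl   = pa<p1+j
    ... | inj₁ 1+j<k  = stays-above-a up<1+j 1+j<k k≤m pa<p1+j

    up-to-j-block : IsBlock m p (suc up) j
    up-to-j-block k k≤m outside = inj₂ λ i up<i i≤j → <-≤-trans (up-to-j-below-a up<i i≤j) (a≤ outside)
      where
      a≤ : k < suc up ⊎ j < k → p a ≤ p k
      a≤ (inj₂ j<k) = <⇒≤ (after-j-above-a j<k k≤m)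
      a≤ (inj₁ k<1+up) with k ≟ a
      ... | yes refl = ≤-refl
      ... | no k≢a   = <⇒≤ (<-trans pa<R (before-up-above-R (≤-pred k<1+up) k≢a))

    j≡1+up : suc up ≡ j
    j≡1+up with simple up<j (<⇒≤ j<m) up-to-j-block
    ... | inj₁ eq     = eq
    ... | inj₂ (() , _)

    after-j-block : IsBlock m p (suc j) m
    after-j-block k k≤m (inj₂ m<k) = contradiction k≤m (<⇒≱ m<k)
    after-j-block k k≤m (inj₁ k≤j) with up <? k
    ... | yes up<k = inj₁ λ i j<i i≤m → <-trans (up-to-j-below-a up<k (≤-pred k≤j)) (after-j-above-a j<i i≤m)
    ... | no k≯up with k ≟ a
    ...   | yes refl = inj₁ λ i j<i i≤m → after-j-above-a j<i i≤m
    ...   | no k≢a   = inj₂ λ i j<i i≤m →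
              ≤-<-trans (after-up-≤R (<-≤-trans up<1+j j<i) i≤m) (before-up-above-R (≮⇒≥ k≯up) k≢a)

    m≡1+j : suc j ≡ m
    m≡1+j with simple j<m ≤-refl after-j-block
    ... | inj₁ eq     = eq
    ... | inj₂ (() , _)

    a≡1 : a ≡ 1
    a≡1 = cong suc a′≡0

    up≡2 : up ≡ 2
    up≡2 = trans (sym up≡2+a′) (cong suc a≡1)

    m≡4 : m ≡ 4
    m≡4 = trans (sym m≡1+j) (cong suc (trans (sym j≡1+up) (cong suc up≡2)))

    down≡3 : down ≡ 3
    down≡3 = ≤-antisym (≤-pred (subst (down <_) m≡4 down<m)) (subst (_< down) up≡2 up<down)

    shape : HasOneLine m p (4 ∷ 2 ∷ 5 ∷ 1 ∷ 3 ∷ [])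
    shape with three-between-0-and-4 (subst (_< p a) p-down pdown<pa) pa<R last<first
                 (subst (L <_) (trans p-up m≡4) L<pup)
    ... | pa≡1 , R≡2 , L≡3 = subst (λ n → HasOneLine n p (4 ∷ 2 ∷ 5 ∷ 1 ∷ 3 ∷ [])) (sym m≡4)
      (five-values L≡3 (trans (cong p (sym a≡1)) pa≡1) (trans (cong p (sym up≡2)) (trans p-up m≡4))
        (trans (cong p (sym down≡3)) p-down) (trans (cong p (sym m≡4)) R≡2))

  module NoLowPointInA-NoHighPointInC
    (A-above-R : ∀ {i} → 0 < i → i < up → ¬ p i < R)
    (C-below-L : ∀ {q} → down < q → q < m → ¬ L < p q) where

    B-decreasing : ∀ {i j} → up < i → i < j → j < down → p j < p i
    B-decreasing {i} {j} up<i i<j j<down = p≯⇒p< j≤m i≤m (>⇒≢ i<j) λ pi<pj →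
      avoids-4231 up<i i<j j<down down≤m (above-down i≤m (<⇒≢ (<-trans i<j j<down))) pi<pj
        (below-up j≤m (>⇒≢ (<-trans up<i i<j)))
      where
      j≤m = <⇒≤ (<-trans j<down down<m)
      i≤m = <⇒≤ (<-trans (<-trans i<j j<down) down<m)

    open Crossing (crossing (λ x → R <? p x) (<⇒≤ up<down) R<pup (<-asym pdown<R))
      renaming (point to k; from≤ to up≤k; <to to k<down; holds to R<pk; fails-after to ¬R<p1+k)

    k<m : k < m
    k<m = <-trans k<down down<m

    prefix-above-R : ∀ {i} → i ≤ k → R < p i
    prefix-above-R {zero}  _ = last<first
    prefix-above-R {suc i} i≤k with <-cmp (suc i) up
    ... | tri< i<up _ _ =
            p≯⇒p< ≤-refl (<⇒≤ (<-trans i<up up<m)) (>⇒≢ (<-trans i<up up<m)) (A-above-R z<s i<up)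
    ... | tri≈ _ refl _ = R<pup
    ... | tri> _ _ up<i with m≤n⇒m<n∨m≡n i≤k
    ...   | inj₁ i<k = <-trans R<pk (B-decreasing up<i i<k k<down)
    ...   | inj₂ i≡k = subst (λ x → R < p x) (sym i≡k) R<pk

    after-k-to-down-≤R : ∀ {q} → k < q → q ≤ down → p q ≤ R
    after-k-to-down-≤R {q} k<q q≤down with m≤n⇒m<n∨m≡n q≤down | m≤n⇒m<n∨m≡n k<q
    ... | inj₂ refl | _         = <⇒≤ pdown<R
    ... | inj₁ _    | inj₂ refl = ≮⇒≥ ¬R<p1+k
    ... | inj₁ q<down | inj₁ 1+k<q =
            <⇒≤ (<-≤-trans (B-decreasing (s≤s up≤k) 1+k<q q<down) (≮⇒≥ ¬R<p1+k))

    C-below-prefix : ∀ {i q} → i ≤ k → down < q → q < m → p q < p i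
    C-below-prefix {i} {q} i≤k down<q q<m with compare (<⇒≤ q<m) ≤-refl (<⇒≢ q<m)
    ... | inj₁ pq<R = <-trans pq<R (prefix-above-R i≤k)
    ... | inj₂ R<pq = p≯⇒p< q≤m i≤m (>⇒≢ (≤-<-trans i≤k (<-trans k<down down<q))) (refute i≤k)
      where
      q≤m = <⇒≤ q<m
      i≤m = ≤-trans i≤k (<⇒≤ k<m)
      pq<L : p q < L
      pq<L = p≯⇒p< q≤m z≤n (>⇒≢ (≤-<-trans z≤n down<q)) (C-below-L down<q q<m)
      refute : ∀ {i} → i ≤ k → ¬ p i < p q
      refute {zero}  _   L<pq = <-asym L<pq pq<L
      refute {suc i} i≤k pi<pq with <-cmp (suc i) up
      ... | tri< i<up _ _ =
              avoids-4231 z<s (<-trans i<up (<-trans up<down down<q)) q<m ≤-refl (prefix-above-R i≤k) pi<pq pq<L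
      ... | tri≈ _ refl _ = <-asym pi<pq (below-up q≤m (>⇒≢ (<-trans up<down down<q)))
      ... | tri> _ _ up<i =
              avoids-4231 up<i (≤-<-trans i≤k (<-trans k<down down<q)) q<m ≤-refl (prefix-above-R i≤k) pi<pq
                (below-up q≤m (>⇒≢ (<-trans up<down down<q)))

    after-k-below-prefix : ∀ {i q} → i ≤ k → k < q → q ≤ m → p q < p i
    after-k-below-prefix i≤k k<q q≤m with <-cmp _ down
    ... | tri< q<down _ _ = ≤-<-trans (after-k-to-down-≤R k<q (<⇒≤ q<down)) (prefix-above-R i≤k)
    ... | tri≈ _ refl _   = ≤-<-trans (after-k-to-down-≤R k<q ≤-refl) (prefix-above-R i≤k)
    ... | tri> _ _ down<q with m≤n⇒m<n∨m≡n q≤m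
    ...   | inj₁ q<m  = C-below-prefix i≤k down<q q<m
    ...   | inj₂ refl = prefix-above-R i≤k

    prefix-block : IsBlock m p 0 k
    prefix-block q q≤m (inj₁ ())
    prefix-block q q≤m (inj₂ k<q) = inj₁ λ i _ i≤k → after-k-below-prefix i≤k k<q q≤m

    impossible : ⊥
    impossible with simple z≤n (<⇒≤ k<m) prefix-block
    ... | inj₁ 0≡k       = contradiction 0≡k (<⇒≢ (<-≤-trans 0<up up≤k))
    ... | inj₂ (_ , k≡m) = contradiction k≡m (<⇒≢ k<m)

low-point-shape : ∀ {m p} (S : SimpleAvoider m p) (C : Corners m p) → ∀ {a} →
  0 < a → a < Corners.up C → p a < p m → HasOneLine m p (4 ∷ 2 ∷ 5 ∷ 1 ∷ 3 ∷ [])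
low-point-shape S C {suc a′} _ = Configuration.LowPointInA.shape S C a′

module _ {m : ℕ} {p : ℕ → ℕ} (S : SimpleAvoider m p) (C : Corners m p) where
  open SimpleAvoider S
  open Corners C
  open ReverseComplement S

  classify : HasOneLine m p (4 ∷ 2 ∷ 5 ∷ 1 ∷ 3 ∷ []) ⊎ HasOneLine m p (3 ∷ 5 ∷ 1 ∷ 4 ∷ 2 ∷ [])
  classify with anyUpTo? (λ a → 0 <? a ×-dec p a <? p m) up
  ... | yes (a , a<up , 0<a , pa<R) = inj₁ (low-point-shape S C 0<a a<up pa<R)
  ... | no no-low with anyUpTo? (λ q → down <? q ×-dec p 0 <? p q) m
  ...   | yes (q , q<m , down<q , L<pq) =
            inj₂ (unreverse-42513 bounded
              (low-point-shape reflected (reflected-corners C) (m<n⇒0<n∸m q<m) (∸-monoʳ-< down<q (<⇒≤ q<m))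
                (reflected-low-point (<⇒≤ q<m) L<pq)))
  ...   | no no-high = ⊥-elim (Configuration.NoLowPointInA-NoHighPointInC.impossible S C
            (λ 0<i i<up pi<R → no-low (_ , i<up , 0<i , pi<R))
            (λ down<q q<m L<pq → no-high (_ , q<m , down<q , L<pq)))

contains-by-relabelling : ∀ {n} (π : Fin n → Fin n) (τ : List ℕ) (f : Fin (length τ) → Fin n)
  (w : ℕ → ℕ) →
  (∀ i j → toℕ i < toℕ j → toℕ (f i) < toℕ (f j)) →
  (∀ i j → nth τ (toℕ i) < nth τ (toℕ j) → w (nth τ (toℕ i)) < w (nth τ (toℕ j))) →
  (∀ i → toℕ (π (f i)) ≡ w (nth τ (toℕ i))) →
  Contains τ π
contains-by-relabelling π τ f w f-increasing w-increasing relabel =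
  f , f-increasing , λ i j → mk⇔ (forward i j) (backward i j)
  where
  forward : ∀ i j → nth τ (toℕ i) < nth τ (toℕ j) → toℕ (π (f i)) < toℕ (π (f j))
  forward i j lt = subst₂ _<_ (sym (relabel i)) (sym (relabel j)) (w-increasing i j lt)

  backward : ∀ i j → toℕ (π (f i)) < toℕ (π (f j)) → nth τ (toℕ i) < nth τ (toℕ j)
  backward i j lt with <-cmp (nth τ (toℕ i)) (nth τ (toℕ j))
  ... | tri< τi<τj _ _ = τi<τj
  ... | tri≈ _ τi≡τj _ =
    contradiction (trans (relabel i) (trans (cong w τi≡τj) (sym (relabel j)))) (<⇒≢ lt)
  ... | tri> _ _ τj<τi = contradiction lt (<-asym (forward j i τj<τi))

injective⇒surjective : ∀ {n} {π : Fin n → Fin n} → Injective _≡_ _≡_ π → ∀ y → ∃ λ x → π x ≡ y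
injective⇒surjective {suc n} {π} inj y with any? (λ x → π x ≟ᶠ y)
... | yes hit  = hit
... | no miss with pigeonhole (n<1+n n) (λ x → punchOut {i = y} {j = π x} λ y≡πx → miss (x , sym y≡πx))
...   | i , j , i<j , eq = contradiction (cong toℕ (inj (punchOut-injective {i = y} _ _ eq))) (<⇒≢ i<j)

module Values {m : ℕ} (π : Fin (suc m) → Fin (suc m)) where

  -- π read as a function on ℕ; beyond m the value 0 is junk
  p : ℕ → ℕ
  p k with k <? suc m
  ... | yes k<1+m = toℕ (π (fromℕ< k<1+m))
  ... | no _      = 0

  p-fromℕ< : ∀ {k} (k<1+m : k < suc m) → p k ≡ toℕ (π (fromℕ< k<1+m))
  p-fromℕ< {k} k<1+m with k <? suc m
  ... | yes _   = refl
  ... | no k≮ = contradiction k<1+m k≮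

  p-toℕ : ∀ i → p (toℕ i) ≡ toℕ (π i)
  p-toℕ i = trans (p-fromℕ< (toℕ<n i)) (cong (toℕ ∘ π) (fromℕ<-toℕ i (toℕ<n i)))

  contains-at : ∀ {a b c d t₀ t₁ t₂ t₃} (σ : List ℕ) → True (inverse? (t₀ ∷ t₁ ∷ t₂ ∷ t₃ ∷ []) σ) →
    a < b → b < c → c < d → d ≤ m → Linked _<_ (map (λ x → p (nth (a ∷ b ∷ c ∷ d ∷ suc m ∷ []) x)) σ) →
    Contains (t₀ ∷ t₁ ∷ t₂ ∷ t₃ ∷ []) π
  contains-at {a} {b} {c} {d} {t₀} {t₁} {t₂} {t₃} σ inverse-ok a<b b<c c<d d≤m values-increasing =
    contains-by-relabelling π τ f w f-increasing w-increasing relabel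
    where
    τ = t₀ ∷ t₁ ∷ t₂ ∷ t₃ ∷ []
    -- the sentinel suc m bounds the four positions
    positions = a ∷ b ∷ c ∷ d ∷ suc m ∷ []
    values = map (λ x → p (nth positions x)) σ
    inverse = toWitness inverse-ok

    positions-increasing : Linked _<_ positions
    positions-increasing = a<b ∷ b<c ∷ c<d ∷ s≤s d≤m ∷ [-]

    position<1+m : ∀ (i : Fin 4) → nth positions (toℕ i) < suc m
    position<1+m i = nth-increasing positions-increasing (toℕ<n i) ≤-refl

    f : Fin 4 → Fin (suc m)
    f i = fromℕ< (position<1+m i)

    f-increasing : ∀ i j → toℕ i < toℕ j → toℕ (f i) < toℕ (f j)
    f-increasing i j lt = subst₂ _<_ (sym (toℕ-fromℕ< _)) (sym (toℕ-fromℕ< _))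
      (nth-increasing positions-increasing lt (m<n⇒m<1+n (toℕ<n j)))

    w : ℕ → ℕ
    w x = nth values (x ∸ 1)

    w-increasing : ∀ i j → nth τ (toℕ i) < nth τ (toℕ j) → w (nth τ (toℕ i)) < w (nth τ (toℕ j))
    w-increasing i j lt with inverse (toℕ<n i) | inverse (toℕ<n j)
    ... | 1≤τi , _ , _ | _ , τj<len , _ =
      nth-increasing values-increasing (∸-monoˡ-< lt 1≤τi) (subst (_ <_) (sym (length-map _ σ)) τj<len)

    relabel : ∀ i → toℕ (π (f i)) ≡ w (nth τ (toℕ i))
    relabel i with inverse (toℕ<n i)
    ... | _ , τi<len , σ∘τ≡id = begin
      toℕ (π (f i))                                  ≡⟨ p-fromℕ< (position<1+m i) ⟨
      p (nth positions (toℕ i))                      ≡⟨ cong (p ∘ nth positions) σ∘τ≡id ⟨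
      p (nth positions (nth σ (nth τ (toℕ i) ∸ 1)))  ≡⟨ nth-map (p ∘ nth positions) σ τi<len ⟨
      w (nth τ (toℕ i))                              ∎
      where open ≡-Reasoning

  block⇒interval : IsPermutation π → ∀ {a b} → a ≤ b → b ≤ m → IsBlock m p a b → IsInterval π a b
  block⇒interval inj {a} {b} a≤b b≤m block = a≤b , s≤s b≤m , fill
    where
    outside : ∀ {i j k v} → a ≤ toℕ i → toℕ i ≤ b → a ≤ toℕ j → toℕ j ≤ b →
              toℕ (π i) ≤ v → v ≤ toℕ (π j) → toℕ (π k) ≡ v → toℕ k < a ⊎ b < toℕ k → ⊥
    outside {i} {j} {k} a≤i i≤b a≤j j≤b i≤v v≤j πk≡v out with block (toℕ k) (≤-pred (toℕ<n k)) out
    ... | inj₁ below = <⇒≱ (subst₂ _<_ (trans (p-toℕ k) πk≡v) (p-toℕ i) (below (toℕ i) a≤i i≤b)) i≤v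
    ... | inj₂ above = <⇒≱ (subst₂ _<_ (p-toℕ j) (trans (p-toℕ k) πk≡v) (above (toℕ j) a≤j j≤b)) v≤j

    fill : (i j : Fin (suc m)) → a ≤ toℕ i → toℕ i ≤ b → a ≤ toℕ j → toℕ j ≤ b →
           (v : ℕ) → toℕ (π i) ≤ v → v ≤ toℕ (π j) → ∃ λ k → a ≤ toℕ k × toℕ k ≤ b × toℕ (π k) ≡ v
    fill i j a≤i i≤b a≤j j≤b v i≤v v≤j
      with injective⇒surjective inj (fromℕ< (≤-<-trans v≤j (toℕ<n (π j))))
    ... | k , πk≡v′ with trans (cong toℕ πk≡v′) (toℕ-fromℕ< _) | a ≤? toℕ k | toℕ k ≤? b
    ...   | πk≡v | yes a≤k | yes k≤b = k , a≤k , k≤b , πk≡v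
    ...   | πk≡v | no a≰k  | _       = ⊥-elim (outside a≤i i≤b a≤j j≤b i≤v v≤j πk≡v (inj₁ (≰⇒> a≰k)))
    ...   | πk≡v | yes _   | no k≰b  = ⊥-elim (outside a≤i i≤b a≤j j≤b i≤v v≤j πk≡v (inj₂ (≰⇒> k≰b)))

  avoider : IsPermutation π → IsSimple π →
    Avoids (2 ∷ 1 ∷ 4 ∷ 3 ∷ []) π → Avoids (4 ∷ 2 ∷ 3 ∷ 1 ∷ []) π → SimpleAvoider m p
  avoider inj simple avoids-2143 avoids-4231 = record
    { bounded     = λ k≤m → subst (_≤ m) (sym (p-fromℕ< (s≤s k≤m))) (≤-pred (toℕ<n _))
    ; injective   = λ {i} {j} i≤m j≤m pi≡pj → begin
        i                        ≡⟨ toℕ-fromℕ< (s≤s i≤m) ⟨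
        toℕ (fromℕ< (s≤s i≤m))   ≡⟨ cong toℕ (inj (toℕ-injective
                                      (trans (sym (p-fromℕ< (s≤s i≤m))) (trans pi≡pj (p-fromℕ< (s≤s j≤m)))))) ⟩
        toℕ (fromℕ< (s≤s j≤m))   ≡⟨ toℕ-fromℕ< (s≤s j≤m) ⟩
        j                        ∎
    ; avoids-2143 = λ a<b b<c c<d d≤m pb<pa pa<pd pd<pc →
        avoids-2143 (contains-at (1 ∷ 0 ∷ 3 ∷ 2 ∷ []) _ a<b b<c c<d d≤m (pb<pa ∷ pa<pd ∷ pd<pc ∷ [-]))
    ; avoids-4231 = λ a<b b<c c<d d≤m pd<pb pb<pc pc<pa →
        avoids-4231 (contains-at (3 ∷ 1 ∷ 2 ∷ 0 ∷ []) _ a<b b<c c<d d≤m (pd<pb ∷ pb<pc ∷ pc<pa ∷ [-]))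
    ; simple      = λ a≤b b≤m block →
        Sum.map₂ (Product.map₂ suc-injective) (simple _ _ (block⇒interval inj a≤b b≤m block))
    }
    where open ≡-Reasoning

  corners : (pu pd : Fin (suc m)) → π pu ≡ fromℕ m → π pd ≡ zero →
    0 < toℕ pu → toℕ pu < toℕ pd → toℕ pd < m → toℕ (π (fromℕ m)) < toℕ (π zero) → Corners m p
  corners pu pd π-pu π-pd 0<pu pu<pd pd<m last<first = record
    { up         = toℕ pu
    ; down       = toℕ pd
    ; p-up       = trans (p-toℕ pu) (trans (cong toℕ π-pu) (toℕ-fromℕ m))
    ; p-down     = trans (p-toℕ pd) (cong toℕ π-pd)
    ; 0<up       = 0<pu
    ; up<down    = pu<pd
    ; down<m     = pd<m
    ; last<first = subst₂ _<_ (sym (trans (cong p (sym (toℕ-fromℕ m))) (p-toℕ (fromℕ m))))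
                     (sym (p-toℕ zero)) last<first
    }

  one-line : ∀ {ws} → HasOneLine m p ws → OneLine π ws
  one-line (length≡ , values) =
    length≡ , λ i → trans (cong suc (sym (p-toℕ i))) (values (≤-pred (toℕ<n i)))

-- n ≥ 4 and the outer inequalities of the pattern 3412 are implied by the other hypotheses.
lemma2 : (m : ℕ) → 3 ≤ m → (π : Fin (suc m) → Fin (suc m)) → IsPermutation π →
    IsSimple π →
    Avoids (2 ∷ 1 ∷ 4 ∷ 3 ∷ []) π → Avoids (4 ∷ 2 ∷ 3 ∷ 1 ∷ []) π →
    (pu pd : Fin (suc m)) → π pu ≡ fromℕ m → π pd ≡ zero →
    0 < toℕ pu → toℕ pu < toℕ pd → toℕ pd < m →
    toℕ (π pd) < toℕ (π (fromℕ m)) →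
    toℕ (π (fromℕ m)) < toℕ (π zero) →
    toℕ (π zero) < toℕ (π pu) →
    OneLine π (4 ∷ 2 ∷ 5 ∷ 1 ∷ 3 ∷ []) ⊎ OneLine π (3 ∷ 5 ∷ 1 ∷ 4 ∷ 2 ∷ [])
lemma2 m _ π inj simple avoids-2143 avoids-4231 pu pd π-pu π-pd 0<pu pu<pd pd<m _ last<first _ =
  Sum.map one-line one-line
    (classify (avoider inj simple avoids-2143 avoids-4231)
              (corners pu pd π-pu π-pd 0<pu pu<pd pd<m last<first))
  where open Values π
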